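{- Let $S=(a_h)_{h\in\mathbb{Z}}$ be a complete folding sequence, let $T$ be a finite subword of $S$, and let $r\in\mathbb{N}$ satisfy $|T|\le 2^r$. Then for every $h\in\mathbb{Z}$, $T$ is a subword of $(a_{h+1},\dots,a_{h+10\cdot 2^r-2})$.
   Context: All sequences take values in $\{+1,-1\}$; $|T|$ denotes the length of a finite sequence $T$. For $S=(a_1,\dots,a_n)$ write $\overline{S}=(-a_n,\dots,-a_1)$. The $n$-folding sequences are defined recursively: the only $0$-folding sequence is the empty sequence, and the $(n+1)$-folding sequences are exactly $(\overline{S},+1,S)$ and $(\overline{S},-1,S)$ with $S$ an $n$-folding sequence. A finite sequence $(u_1,\dots,u_m)$ is a subword of a sequence $(b_k)$ if there is $h$ with $u_k=b_{k+h}$ for $1\le k\le m$. A complete folding sequence is a sequence $(a_k)_{k\in\mathbb{Z}}$ each finite subword of which is a subword of some $n$-folding sequence. -}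

module Defs where

open import Data.Bool using (Bool; true; false; not)
open import Data.Nat using (ℕ; zero; suc; _<_)
open import Data.Integer using (ℤ; +_; _+_)
open import Data.List using (List; []; _∷_; _++_; reverse; map; length; lookup)
open import Data.Fin using (toℕ)
open import Data.Product using (Σ; ∃; _×_; _,_)
open import Relation.Binary.PropositionalEquality using (_≡_)

-- Signs: true encodes +1, false encodes -1.
Sign : Set
Sign = Bool

neg : Sign → Sign
neg = not

bar : List Sign → List Sign
bar S = reverse (map neg S)

data FoldingSeq : ℕ → List Sign → Set where
  fold-zero : FoldingSeq zero []
  fold-suc  : ∀ {n S} → FoldingSeq n S → (b : Sign) → FoldingSeq (suc n) (bar S ++ (b ∷ S))

SubwordL : List Sign → List Sign → Set
SubwordL u L = Σ (List Sign) λ pre → Σ (List Sign) λ suf → L ≡ pre ++ (u ++ suf)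

BiSeq : Set
BiSeq = ℤ → Sign

-- u = (u_1,…,u_m) is a subword of (a_k)_{k∈ℤ}: ∃ h, u_k = a_{k+h} for 1 ≤ k ≤ m
-- (with 0-based list indices i = k - 1, so u_k = a (h + (i+1)))
SubwordZ : List Sign → BiSeq → Set
SubwordZ u a = Σ ℤ λ h → ∀ i → lookup u i ≡ a (h + + suc (toℕ i))

CompleteFolding : BiSeq → Set
CompleteFolding a = ∀ u → SubwordZ u a →
  Σ ℕ λ n → Σ (List Sign) λ S → FoldingSeq n S × SubwordL u S

window : BiSeq → ℤ → ℕ → List Sign
window a h zero = []
window a h (suc m) = a (h + + 1) ∷ window a (h + + 1) m

module Submission where

-- Read an n-folding sequence F backwards, R = reverse F with 1-based terms R(1), …, R(2ⁿ - 1).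
-- Unfolding F = (S̄, b, S) shows that R obeys the alternation law R(2ʲ(2o+3)) = -R(2ʲ(2o+1)).
-- Two consequences: off the multiples of 2ʳ, R is periodic with period 2ʳ⁺¹; and above a multiple
-- e of 2ʳ, both signs occur among R(e), R(e + 2ʳ⁺¹), R(e + 2·2ʳ⁺¹), R(e + 3·2ʳ⁺¹).  A block of at
-- most 2ʳ terms contains at most one multiple of 2ʳ, so shifting it by a suitable multiple of
-- 2ʳ⁺¹ (one of four candidates) reproduces it inside any window of length ≥ 9·2ʳ - 1.  This is the
-- finite theorem for folding sequences; for the bi-infinite sequence, T and the target window lie
-- in a common window of a, which by completeness is a subword of some folding sequence.

open import Defs
open import Data.Bool using (true; false)
open import Data.Bool.Properties using (not-involutive)
open import Data.Nat using (ℕ; _∸_; NonZero; >-nonZero⁻¹; zero; suc; pred; z<s; _+_; _*_; _^_; _≤_; _<_; z≤n; s≤s; _≤?_)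
open import Data.Nat.Properties
open import Data.Nat.Induction using (<-rec)
open import Data.Nat.Divisibility using (_∣_; divides; _∣?_; >⇒∤; ∣m+n∣m⇒∣n; ∣m∣n⇒∣m+n; ∣m⇒∣m*n; ∣n⇒∣m*n; m∣m*n; n∣m*n)
open import Data.Integer using (ℤ)
import Data.Integer as Z
import Data.Integer.Properties as ZP
open import Data.Integer.Tactic.RingSolver renaming (solve-∀ to Z-solve-∀)
open import Data.Fin using (Fin; zero; suc; toℕ; fromℕ<)
open import Data.Fin.Properties using (any?; toℕ<n; toℕ-fromℕ<)
open import Data.Nat.DivMod using (_%_; _/_; m≡m%n+[m/n]*n; m%n<n)
open import Data.List using (List; []; _∷_; _++_; reverse; map; length; lookup)
open import Data.List.Properties using (reverse-++; reverse-involutive; length-++; length-reverse; length-map; ++-assoc; unfold-reverse)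
open import Data.Product using (∃; ∃₂; _×_; _,_; proj₂)
open import Data.Sum using (_⊎_; inj₁; inj₂)
open import Relation.Nullary using (Dec; yes; no; ¬_; contradiction)
open import Relation.Binary.PropositionalEquality
open import Relation.Binary using (Tri; tri<; tri≈; tri>)
open import Data.Nat.Tactic.RingSolver using (solve-∀)

-- Entries of a list, 0-based; the default value for out-of-range indices is never used.
at : List Sign → ℕ → Sign
at []       _       = true
at (x ∷ xs) zero    = x
at (x ∷ xs) (suc i) = at xs i

-- Terms of a list, 1-based, as in the paper: term R e = at R (e - 1).
term : List Sign → ℕ → Sign
term R e = at R (pred e)

at-++ˡ : ∀ A B i → i < length A → at (A ++ B) i ≡ at A i
at-++ˡ (x ∷ A) B zero    _        = refl
at-++ˡ (x ∷ A) B (suc i) (s≤s i<) = at-++ˡ A B i i<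

at-++ʳ : ∀ A B i → at (A ++ B) (length A + i) ≡ at B i
at-++ʳ []      B i = refl
at-++ʳ (x ∷ A) B i = at-++ʳ A B i

at-map-neg : ∀ A i → i < length A → at (map neg A) i ≡ neg (at A i)
at-map-neg (x ∷ A) zero    _        = refl
at-map-neg (x ∷ A) (suc i) (s≤s i<) = at-map-neg A i i<

at-reverse : ∀ A i j → i + suc j ≡ length A → at (reverse A) i ≡ at A j
at-reverse []      i j eq = contradiction (trans (sym (+-suc i j)) eq) λ ()
at-reverse (x ∷ A) i zero eq rewrite unfold-reverse x A =
  subst (λ k → at (reverse A ++ x ∷ []) k ≡ x) (sym i≡) (at-++ʳ (reverse A) (x ∷ []) 0)
  where
    i≡ : i ≡ length (reverse A) + 0
    i≡ = trans (suc-injective (trans (+-comm 1 i) eq)) (sym (trans (+-identityʳ _) (length-reverse A)))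
at-reverse (x ∷ A) i (suc j) eq rewrite unfold-reverse x A =
  trans (at-++ˡ (reverse A) (x ∷ []) i i<) (at-reverse A i j eq′)
  where
    eq′ : i + suc j ≡ length A
    eq′ = suc-injective (trans (sym (+-suc i (suc j))) eq)
    i< : i < length (reverse A)
    i< = subst (i <_) (trans eq′ (sym (length-reverse A))) (m<m+n i z<s)

opposite-signs-cover : ∀ x y → x ≡ neg y → ∀ v → y ≡ v ⊎ x ≡ v
opposite-signs-cover x false refl false = inj₁ refl
opposite-signs-cover x false refl true  = inj₂ refl
opposite-signs-cover x true  refl false = inj₂ refl
opposite-signs-cover x true  refl true  = inj₁ refl

Occurs : List Sign → List Sign → ℕ → Set
Occurs X Y k = k + length X ≤ length Y × (∀ t → t < length X → at X t ≡ at Y (k + t))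

subword⇒occurs : ∀ X Y → SubwordL X Y → ∃ (Occurs X Y)
subword⇒occurs X Y (pre , suf , refl) = length pre , fits , agrees
  where
    fits : length pre + length X ≤ length (pre ++ X ++ suf)
    fits = subst (length pre + length X ≤_)
             (sym (trans (length-++ pre) (cong (length pre +_) (length-++ X))))
             (+-monoʳ-≤ (length pre) (m≤m+n (length X) (length suf)))
    agrees : ∀ t → t < length X → at X t ≡ at (pre ++ X ++ suf) (length pre + t)
    agrees t t< = sym (trans (at-++ʳ pre (X ++ suf) t) (at-++ˡ X suf t t<))

occurs-at-0⇒prefix : ∀ X Y → Occurs X Y 0 → ∃ λ suf → Y ≡ X ++ suf
occurs-at-0⇒prefix []      Y       _             = Y , refl
occurs-at-0⇒prefix (x ∷ X) (y ∷ Y) (s≤s fits , agrees)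
  with occurs-at-0⇒prefix X Y (fits , λ t t< → agrees (suc t) (s≤s t<))
... | suf , Y≡ = suf , cong₂ _∷_ (sym (agrees 0 z<s)) Y≡

occurs⇒subword : ∀ X Y k → Occurs X Y k → SubwordL X Y
occurs⇒subword X Y zero occ with occurs-at-0⇒prefix X Y occ
... | suf , Y≡ = [] , suf , Y≡
occurs⇒subword X (y ∷ Y) (suc k) (s≤s fits , agrees) with occurs⇒subword X Y k (fits , agrees)
... | pre , suf , Y≡ = y ∷ pre , suf , cong (y ∷_) Y≡

subword-reverse : ∀ {X Y} → SubwordL X Y → SubwordL (reverse X) (reverse Y)
subword-reverse {X} (pre , suf , refl) = reverse suf , reverse pre , (begin
    reverse (pre ++ X ++ suf)              ≡⟨ reverse-++ pre (X ++ suf) ⟩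
    reverse (X ++ suf) ++ reverse pre      ≡⟨ cong (_++ reverse pre) (reverse-++ X suf) ⟩
    (reverse suf ++ reverse X) ++ reverse pre ≡⟨ ++-assoc (reverse suf) (reverse X) (reverse pre) ⟩
    reverse suf ++ reverse X ++ reverse pre ∎)
  where open ≡-Reasoning

subword-trans : ∀ {X Y Z} → SubwordL X Y → SubwordL Y Z → SubwordL X Z
subword-trans {X} (pre₁ , suf₁ , refl) (pre₂ , suf₂ , refl) = pre₂ ++ pre₁ , suf₁ ++ suf₂ , (begin
    pre₂ ++ (pre₁ ++ X ++ suf₁) ++ suf₂     ≡⟨ cong (pre₂ ++_) (++-assoc pre₁ (X ++ suf₁) suf₂) ⟩
    pre₂ ++ pre₁ ++ (X ++ suf₁) ++ suf₂     ≡⟨ cong (λ Z → pre₂ ++ pre₁ ++ Z) (++-assoc X suf₁ suf₂) ⟩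
    pre₂ ++ pre₁ ++ X ++ suf₁ ++ suf₂       ≡⟨ ++-assoc pre₂ pre₁ _ ⟨
    (pre₂ ++ pre₁) ++ X ++ suf₁ ++ suf₂     ∎)
  where open ≡-Reasoning

parity : ∀ n → ∃ λ q → n ≡ 2 * q ⊎ n ≡ suc (2 * q)
parity zero = 0 , inj₁ refl
parity (suc n) with parity n
... | q , inj₁ n≡ = q , inj₂ (cong suc n≡)
... | q , inj₂ n≡ = suc q , inj₁ (trans (cong suc n≡) (double-suc q))
  where
    double-suc : ∀ q → suc (suc (2 * q)) ≡ 2 * suc q
    double-suc = solve-∀

-- The number 2ʲ·(2o+1).  Every positive number has this shape, and the terms of a reversed
-- folding sequence are governed by j and the parity of o.
oddMul : ℕ → ℕ → ℕ
oddMul j o = 2 ^ j * suc (2 * o)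

oddMul-positive : ∀ j o → 0 < oddMul j o
oddMul-positive j o = >-nonZero⁻¹ (oddMul j o) {{m*n≢0 (2 ^ j) (suc (2 * o)) {{m^n≢0 2 j}}}}

oddMul-increasing : ∀ j o → oddMul j o < oddMul j (suc o)
oddMul-increasing j o = *-monoʳ-< (2 ^ j) {{m^n≢0 2 j}} (s≤s (*-monoʳ-< 2 (n<1+n o)))

odd-part-decomposition : ∀ n → 0 < n → ∃₂ λ j o → n ≡ oddMul j o
odd-part-decomposition = <-rec _ decompose
  where
    decompose : ∀ n → (∀ {m} → m < n → 0 < m → ∃₂ λ j o → m ≡ oddMul j o) →
                0 < n → ∃₂ λ j o → n ≡ oddMul j o
    decompose n rec n>0 with parity n
    ... | q , inj₂ refl = 0 , q , sym (*-identityˡ _)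
    ... | zero , inj₁ refl = contradiction n>0 λ ()
    ... | suc q , inj₁ refl with rec (m<m+n (suc q) z<s) z<s
    ...   | j , o , q≡ = suc j , o , trans (cong (2 *_) q≡) (sym (*-assoc 2 (2 ^ j) _))

power-divides-oddMul : ∀ r j o → r ≤ j → 2 ^ r ∣ oddMul j o
power-divides-oddMul r j o r≤j with m≤n⇒∃[o]m+o≡n r≤j
... | d , refl = subst (λ x → 2 ^ r ∣ x * suc (2 * o)) (sym (^-distribˡ-+-* 2 r d))
                   (∣m⇒∣m*n (suc (2 * o)) (m∣m*n (2 ^ d)))

residue-in-window : ∀ y β D → 0 < D → β < D → ∃ λ c → y ≤ β + c * D × β + c * D < y + D
residue-in-window zero    β D _   β<D = 0 , z≤n , subst (_< D) (sym (+-identityʳ β)) β<D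
residue-in-window (suc y) β D D>0 β<D with residue-in-window y β D D>0 β<D
... | c , y≤ , <y+D with m≤n⇒m<n∨m≡n y≤
...   | inj₁ y< = c , y< , <-trans <y+D (n<1+n (y + D))
...   | inj₂ y≡ = suc c , subst (suc y ≤_) (sym next≡) (m<m+n y D>0) , subst (_< suc y + D) (sym next≡) (n<1+n (y + D))
  where
    one-more : ∀ β c D → β + suc c * D ≡ β + c * D + D
    one-more = solve-∀
    next≡ : β + suc c * D ≡ y + D
    next≡ = trans (one-more β c D) (cong (_+ D) (sym y≡))

divide : ∀ x D .{{_ : NonZero D}} → ∃₂ λ β a → β < D × x ≡ β + a * D
divide x D = x % D , x / D , m%n<n x D , m≡m%n+[m/n]*n x D

multiples-apart : ∀ {P} s k → suc k < P → P ∣ s → ¬ (P ∣ s + suc k)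
multiples-apart s k k<P P∣s P∣s+k = >⇒∤ k<P (∣m+n∣m⇒∣n P∣s+k P∣s)

second-multiple-in-block : ∀ {P} s t t′ → t < t′ → t′ < P → P ∣ s + t → ¬ (P ∣ s + t′)
second-multiple-in-block {P} s t t′ t<t′ t′<P P∣s+t with m≤n⇒∃[o]m+o≡n t<t′
... | k , refl = λ P∣s+t′ → multiples-apart (s + t) k (≤-<-trans (s≤s (m≤n+m k t)) t′<P) P∣s+t
                              (subst (P ∣_) (regroup s t k) P∣s+t′)
  where
    regroup : ∀ s t k → s + suc (t + k) ≡ s + t + suc k
    regroup = solve-∀

multiple-in-block-unique : ∀ {P} s t t′ → t < P → t′ < P → P ∣ s + t → P ∣ s + t′ → t ≡ t′
multiple-in-block-unique s t t′ t<P t′<P P∣s+t P∣s+t′ with <-cmp t t′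
... | tri< t<t′ _ _ = contradiction P∣s+t′ (second-multiple-in-block s t t′ t<t′ t′<P P∣s+t)
... | tri≈ _ t≡t′ _ = t≡t′
... | tri> _ _ t′<t = contradiction P∣s+t (second-multiple-in-block s t′ t t′<t t<P P∣s+t′)

Alternating : List Sign → Set
Alternating R = ∀ j o → oddMul j (suc o) ≤ length R →
                term R (oddMul j (suc o)) ≡ neg (term R (oddMul j o))

-- Reversing the (n+1)-folding sequence (S̄, b, S) gives R′ = (reverse S, b, -S): the old
-- reversed sequence R, then the new middle term at position K, then the mirror image of R negated.
module Unfolding (S : List Sign) (b : Sign) where
  R R′ : List Sign
  R  = reverse S
  R′ = R ++ b ∷ map neg S

  K : ℕ
  K = suc (length S)

  reverse-unfold : reverse (bar S ++ b ∷ S) ≡ R′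
  reverse-unfold = begin
      reverse (bar S ++ b ∷ S)                ≡⟨ reverse-++ (bar S) (b ∷ S) ⟩
      reverse (b ∷ S) ++ reverse (bar S)      ≡⟨ cong₂ _++_ (unfold-reverse b S) (reverse-involutive (map neg S)) ⟩
      (reverse S ++ b ∷ []) ++ map neg S      ≡⟨ ++-assoc (reverse S) (b ∷ []) (map neg S) ⟩
      R′                                      ∎
    where open ≡-Reasoning

  length-R′ : length R′ ≡ length S + K
  length-R′ = trans (length-++ R) (cong₂ (λ m n → m + suc n) (length-reverse S) (length-map neg S))

  term-before : ∀ e → 0 < e → e < K → term R′ e ≡ term R e
  term-before (suc e) _ (s≤s e<) = at-++ˡ R (b ∷ map neg S) e (subst (e <_) (sym (length-reverse S)) e<)

  term-after : ∀ u v → 0 < u → 0 < v → u + v ≡ K → term R′ (K + u) ≡ neg (term R v)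
  term-after (suc u) (suc v) _ _ u+v≡ = begin
      at R′ (length S + suc u)          ≡⟨ cong (λ m → at R′ (m + suc u)) (length-reverse S) ⟨
      at R′ (length R + suc u)          ≡⟨ at-++ʳ R (b ∷ map neg S) (suc u) ⟩
      at (map neg S) u                  ≡⟨ at-map-neg S u (subst (u <_) u+v≡′ (m<m+n u z<s)) ⟩
      neg (at S u)                      ≡⟨ cong neg (at-reverse S v u v+u≡) ⟨
      neg (at R v)                      ∎
    where
      open ≡-Reasoning
      u+v≡′ : u + suc v ≡ length S
      u+v≡′ = suc-injective u+v≡
      v+u≡ : v + suc u ≡ length S
      v+u≡ = trans (+-suc v u) (trans (cong suc (+-comm v u)) (trans (sym (+-suc u v)) u+v≡′))

  AlternatesAt : ℕ → ℕ → Set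
  AlternatesAt j o = term R′ (oddMul j (suc o)) ≡ neg (term R′ (oddMul j o))

  -- both terms lie before the middle: they are terms of R
  alternates-before : Alternating R → ∀ j o g → K ≡ oddMul j (suc o) + oddMul j g → AlternatesAt j o
  alternates-before alt j o g K≡ = begin
      term R′ (oddMul j (suc o))   ≡⟨ term-before _ (oddMul-positive j (suc o)) e′<K ⟩
      term R (oddMul j (suc o))    ≡⟨ alt j o (subst (oddMul j (suc o) ≤_) (sym (length-reverse S)) (≤-pred e′<K)) ⟩
      neg (term R (oddMul j o))    ≡⟨ cong neg (term-before _ (oddMul-positive j o) e<K) ⟨
      neg (term R′ (oddMul j o))   ∎
    where
      open ≡-Reasoning
      e′<K : oddMul j (suc o) < K
      e′<K = subst (oddMul j (suc o) <_) (sym K≡) (m<m+n _ (oddMul-positive j g))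
      e<K : oddMul j o < K
      e<K = <-trans (oddMul-increasing j o) e′<K

  -- the pair straddles the middle, K = 2ʲ(2o+2)
  alternates-across : ∀ j o → oddMul j o + 2 ^ j ≡ K → AlternatesAt j o
  alternates-across j o e+p≡K = begin
      term R′ (oddMul j (suc o))   ≡⟨ cong (term R′) e′≡ ⟩
      term R′ (K + 2 ^ j)          ≡⟨ term-after (2 ^ j) (oddMul j o) (m^n>0 2 j) (oddMul-positive j o) p+e≡K ⟩
      neg (term R (oddMul j o))    ≡⟨ cong neg (term-before _ (oddMul-positive j o) e<K) ⟨
      neg (term R′ (oddMul j o))   ∎
    where
      open ≡-Reasoning
      step-twice : ∀ p o → p * suc (2 * suc o) ≡ (p * suc (2 * o) + p) + p
      step-twice = solve-∀
      e′≡ : oddMul j (suc o) ≡ K + 2 ^ j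
      e′≡ = trans (step-twice (2 ^ j) o) (cong (_+ 2 ^ j) e+p≡K)
      p+e≡K : 2 ^ j + oddMul j o ≡ K
      p+e≡K = trans (+-comm (2 ^ j) _) e+p≡K
      e<K : oddMul j o < K
      e<K = subst (oddMul j o <_) e+p≡K (m<m+n _ (m^n>0 2 j))

  -- both terms lie after the middle: they mirror the pair 2ʲ(2h+1), 2ʲ(2h+3) of R
  alternates-after : Alternating R → ∀ j o g h → oddMul j o ≡ K + oddMul j g →
                     oddMul j g + oddMul j (suc h) ≡ K → AlternatesAt j o
  alternates-after alt j o g h e≡ K≡ = begin
      term R′ (oddMul j (suc o))          ≡⟨ cong (term R′) e′≡ ⟩
      term R′ (K + oddMul j (suc g))      ≡⟨ term-after _ _ (oddMul-positive j (suc g)) (oddMul-positive j h) K≡′ ⟩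
      neg (term R (oddMul j h))           ≡⟨ cong neg (not-involutive _) ⟨
      neg (neg (neg (term R (oddMul j h)))) ≡⟨ cong (λ s → neg (neg s)) (alt j h bound) ⟨
      neg (neg (term R (oddMul j (suc h)))) ≡⟨ cong neg (term-after _ _ (oddMul-positive j g) (oddMul-positive j (suc h)) K≡) ⟨
      neg (term R′ (K + oddMul j g))      ≡⟨ cong (λ e → neg (term R′ e)) e≡ ⟨
      neg (term R′ (oddMul j o))          ∎
    where
      open ≡-Reasoning
      shift : ∀ p o → p * suc (2 * suc o) ≡ p * suc (2 * o) + 2 * p
      shift = solve-∀
      swap : ∀ p g h → p * suc (2 * g) + p * suc (2 * suc h) ≡ p * suc (2 * suc g) + p * suc (2 * h)
      swap = solve-∀
      e′≡ : oddMul j (suc o) ≡ K + oddMul j (suc g)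
      e′≡ = trans (shift (2 ^ j) o)
              (trans (cong (_+ 2 * 2 ^ j) e≡)
                (trans (+-assoc K _ _) (cong (K +_) (sym (shift (2 ^ j) g)))))
      K≡′ : oddMul j (suc g) + oddMul j h ≡ K
      K≡′ = trans (sym (swap (2 ^ j) g h)) K≡
      bound : oddMul j (suc h) ≤ length R
      bound = subst (oddMul j (suc h) ≤_) (sym (length-reverse S))
                (≤-pred (subst (oddMul j (suc h) <_) K≡ (m<n+m _ (oddMul-positive j g))))

  pair-beyond-R′ : ∀ n j o → K ≡ 2 ^ n → n ≤ j → length R′ < oddMul j (suc o)
  pair-beyond-R′ n j o K≡ n≤j = begin-strict
      length R′               ≡⟨ length-R′ ⟩
      length S + K            <⟨ +-monoˡ-< K (n<1+n (length S)) ⟩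
      K + K                   ≤⟨ m≤m+n (K + K) K ⟩
      K + K + K               ≡⟨ thrice K ⟩
      K * 3                   ≡⟨ cong (_* 3) K≡ ⟩
      2 ^ n * 3               ≤⟨ *-monoˡ-≤ 3 (^-monoʳ-≤ 2 n≤j) ⟩
      2 ^ j * 3               ≤⟨ *-monoʳ-≤ (2 ^ j) (s≤s (*-monoʳ-≤ 2 (s≤s z≤n))) ⟩
      oddMul j (suc o)        ∎
    where
      open ≤-Reasoning
      thrice : ∀ K → K + K + K ≡ K * 3
      thrice = solve-∀

  pair-after-fits : ∀ j E g → K ≡ 2 ^ j * (2 * E) → oddMul j (suc (E + g)) ≤ length R′ → 2 + g ≤ E
  pair-after-fits j E g K≡ fits = *-cancelˡ-≤ 2 (subst (_≤ 2 * E) (double-shift g) g<E)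
    where
      four : ∀ p E → p * (2 * E) + p * (2 * E) ≡ p * (2 * (2 * E))
      four = solve-∀
      split : ∀ E g → suc (2 * suc (E + g)) ≡ 2 * E + suc (2 * suc g)
      split = solve-∀
      double : ∀ E → 2 * (2 * E) ≡ 2 * E + 2 * E
      double = solve-∀
      double-shift : ∀ g → suc (suc (2 * suc g)) ≡ 2 * (2 + g)
      double-shift = solve-∀
      in-R′ : 2 ^ j * suc (2 * suc (E + g)) < 2 ^ j * (2 * (2 * E))
      in-R′ = ≤-<-trans fits (subst₂ _<_ (sym length-R′) (trans (cong₂ _+_ K≡ K≡) (four (2 ^ j) E))
                                 (+-monoˡ-< K (n<1+n (length S))))
      g<E : suc (2 * suc g) < 2 * E
      g<E = +-cancelˡ-< (2 * E) _ _ (subst₂ _<_ (split E g) (double E) (*-cancelˡ-< (2 ^ j) _ _ in-R′))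

  -- If K = 2ⁿ and R is alternating, then so is R′: locate the pair relative to the middle.
  alternating-step : ∀ n → K ≡ 2 ^ n → Alternating R → Alternating R′
  alternating-step n K≡2ⁿ alt j o fits with n ≤? j
  ... | yes n≤j = contradiction fits (<⇒≱ (pair-beyond-R′ n j o K≡2ⁿ n≤j))
  ... | no n≰j with m≤n⇒∃[o]m+o≡n (≰⇒> n≰j)
  ...   | d , refl = locate (<-cmp (suc o) (2 ^ d))
    where
      p E : ℕ
      p = 2 ^ j
      E = 2 ^ d
      regroup : ∀ p E → 2 * (p * E) ≡ p * (2 * E)
      regroup = solve-∀
      K≡ : K ≡ p * (2 * E)
      K≡ = trans K≡2ⁿ (trans (cong (2 *_) (^-distribˡ-+-* 2 j d)) (regroup p E))
      before-shape : ∀ p o g → p * (2 * (suc (suc o) + g)) ≡ p * suc (2 * suc o) + p * suc (2 * g)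
      before-shape = solve-∀
      across-shape : ∀ p o → p * suc (2 * o) + p ≡ p * (2 * suc o)
      across-shape = solve-∀
      after-shape₁ : ∀ p E g → p * suc (2 * (E + g)) ≡ p * (2 * E) + p * suc (2 * g)
      after-shape₁ = solve-∀
      after-shape₂ : ∀ p g h → p * suc (2 * g) + p * suc (2 * suc h) ≡ p * (2 * (2 + g + h))
      after-shape₂ = solve-∀
      locate : Tri (suc o < E) (suc o ≡ E) (E < suc o) → AlternatesAt j o
      locate (tri< o+1<E _ _) with m≤n⇒∃[o]m+o≡n o+1<E
      ... | g , E≡ = alternates-before alt j o g
            (trans K≡ (trans (cong (λ x → p * (2 * x)) (sym E≡)) (before-shape p o g)))
      locate (tri≈ _ o+1≡E _) =
        alternates-across j o (trans (across-shape p o) (sym (trans K≡ (cong (λ x → p * (2 * x)) (sym o+1≡E)))))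
      locate (tri> _ _ E<o+1) with m≤n⇒∃[o]m+o≡n (≤-pred E<o+1)
      ... | g , refl with m≤n⇒∃[o]m+o≡n (pair-after-fits j E g K≡ fits)
      ...   | h , E≡ = alternates-after alt j (E + g) g h
              (trans (after-shape₁ p E g) (cong (_+ oddMul j g) (sym K≡)))
              (trans (after-shape₂ p g h) (trans (cong (λ x → p * (2 * x)) E≡) (sym K≡)))

folding-alternating : ∀ {n F} → FoldingSeq n F → suc (length F) ≡ 2 ^ n × Alternating (reverse F)
folding-alternating fold-zero = refl , λ j o fits → contradiction fits (<⇒≱ (oddMul-positive j (suc o)))
folding-alternating (fold-suc {n} {S} folding b) with folding-alternating folding
... | K≡2ⁿ , alt = length≡ , subst Alternating (sym reverse-unfold) (alternating-step n K≡2ⁿ alt)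
  where
    open Unfolding S b
    length≡ : suc (length (bar S ++ b ∷ S)) ≡ 2 ^ suc n
    length≡ = begin
      suc (length (bar S ++ b ∷ S))            ≡⟨ cong suc (length-reverse (bar S ++ b ∷ S)) ⟨
      suc (length (reverse (bar S ++ b ∷ S)))  ≡⟨ cong (λ L → suc (length L)) reverse-unfold ⟩
      suc (length R′)                          ≡⟨ cong suc length-R′ ⟩
      K + K                                    ≡⟨ cong (λ x → x + x) K≡2ⁿ ⟩
      2 ^ n + 2 ^ n                            ≡⟨ cong (2 ^ n +_) (+-identityʳ (2 ^ n)) ⟨
      2 ^ suc n                                ∎
      where open ≡-Reasoning

module AlternatingProperties {R : List Sign} (alt : Alternating R) where

  even-steps : ∀ j o s → oddMul j (o + 2 * s) ≤ length R → term R (oddMul j (o + 2 * s)) ≡ term R (oddMul j o)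
  even-steps j o zero    _    = cong (λ x → term R (oddMul j x)) (+-identityʳ o)
  even-steps j o (suc s) fits = begin
      term R (oddMul j (o + 2 * suc s))   ≡⟨ cong (λ x → term R (oddMul j x)) (two-more o s) ⟩
      term R (oddMul j (suc (suc X)))     ≡⟨ alt j (suc X) fits₂ ⟩
      neg (term R (oddMul j (suc X)))     ≡⟨ cong neg (alt j X fits₁) ⟩
      neg (neg (term R (oddMul j X)))     ≡⟨ not-involutive _ ⟩
      term R (oddMul j X)                 ≡⟨ even-steps j o s fits₀ ⟩
      term R (oddMul j o)                 ∎
    where
      open ≡-Reasoning
      X : ℕ
      X = o + 2 * s
      two-more : ∀ o s → o + 2 * suc s ≡ suc (suc (o + 2 * s))
      two-more = solve-∀
      fits₂ : oddMul j (suc (suc X)) ≤ length R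
      fits₂ = subst (λ x → oddMul j x ≤ length R) (two-more o s) fits
      fits₁ : oddMul j (suc X) ≤ length R
      fits₁ = ≤-trans (<⇒≤ (oddMul-increasing j (suc X))) fits₂
      fits₀ : oddMul j X ≤ length R
      fits₀ = ≤-trans (<⇒≤ (oddMul-increasing j X)) fits₁

  -- Off the multiples of 2ʳ, R is periodic with period 2ʳ⁺¹: writing e = 2ʲ(2o+1) with j < r,
  -- adding k·2ʳ⁺¹ moves an even number of steps along the progression of e.
  periodic-off-multiples : ∀ r e k → 0 < e → ¬ (2 ^ r ∣ e) → e + k * 2 ^ suc r ≤ length R →
                           term R (e + k * 2 ^ suc r) ≡ term R e
  periodic-off-multiples r e k e>0 2ʳ∤e fits with odd-part-decomposition e e>0
  ... | j , o , refl with r ≤? j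
  ...   | yes r≤j = contradiction (power-divides-oddMul r j o r≤j) 2ʳ∤e
  ...   | no r≰j with m≤n⇒∃[o]m+o≡n (≰⇒> r≰j)
  ...     | d , refl = trans (cong (term R) shifted)
                         (even-steps j o (2 ^ d * k) (subst (_≤ length R) shifted fits))
    where
      regroup : ∀ p E o k → p * suc (2 * o) + k * (2 * (2 * (p * E))) ≡ p * suc (2 * (o + 2 * (E * k)))
      regroup = solve-∀
      shifted : oddMul j o + k * 2 ^ suc (suc j + d) ≡ oddMul j (o + 2 * (2 ^ d * k))
      shifted = trans (cong (λ x → oddMul j o + k * (2 * (2 * x))) (^-distribˡ-+-* 2 j d))
                      (regroup (2 ^ j) (2 ^ d) o k)

  OppositePair : ℕ → ℕ → Set
  OppositePair r e = ∃₂ λ κ₁ κ₂ → κ₁ ≤ 3 × κ₂ ≤ 3 ×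
                     term R (e + κ₂ * 2 ^ suc r) ≡ neg (term R (e + κ₁ * 2 ^ suc r))

  consecutive-pair : ∀ r e κ₁ κ₂ j w → κ₁ ≤ 3 → κ₂ ≤ 3 → e + 3 * 2 ^ suc r ≤ length R →
                     e + κ₁ * 2 ^ suc r ≡ oddMul j w → e + κ₂ * 2 ^ suc r ≡ oddMul j (suc w) →
                     OppositePair r e
  consecutive-pair r e κ₁ κ₂ j w κ₁≤3 κ₂≤3 fits first≡ second≡ =
    κ₁ , κ₂ , κ₁≤3 , κ₂≤3 ,
    trans (cong (term R) second≡) (trans (alt j w second-fits) (cong neg (sym (cong (term R) first≡))))
    where
      second-fits : oddMul j (suc w) ≤ length R
      second-fits = subst (_≤ length R) second≡ (≤-trans (+-monoʳ-≤ e (*-monoˡ-≤ (2 ^ suc r) κ₂≤3)) fits)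

  -- Among the four points e, e + 2ʳ⁺¹, e + 2·2ʳ⁺¹, e + 3·2ʳ⁺¹ above a multiple e of 2ʳ, two lie
  -- consecutively on one progression (of 2ʳ if e/2ʳ is odd, of 2ʳ⁺¹ otherwise), so they have
  -- opposite signs.
  opposite-pair : ∀ r e → 2 ^ r ∣ e → e + 3 * 2 ^ suc r ≤ length R → OppositePair r e
  opposite-pair r e (divides q e≡) fits with parity q
  ... | o , inj₂ refl = consecutive-pair r e 0 1 r o z≤n (s≤s z≤n) fits (trans (cong (_+ 0 * 2 ^ suc r) e≡) (odd-start (2 ^ r) o))
                          (trans (cong (_+ 1 * 2 ^ suc r) e≡) (odd-next (2 ^ r) o))
    where
      odd-start : ∀ P o → suc (2 * o) * P + 0 * (2 * P) ≡ P * suc (2 * o)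
      odd-start = solve-∀
      odd-next : ∀ P o → suc (2 * o) * P + 1 * (2 * P) ≡ P * suc (2 * suc o)
      odd-next = solve-∀
  ... | q′ , inj₁ refl with parity q′
  ...   | w , inj₂ refl = consecutive-pair r e 0 2 (suc r) w z≤n (s≤s (s≤s z≤n)) fits (trans (cong (_+ 0 * 2 ^ suc r) e≡) (start (2 ^ r) w))
                            (trans (cong (_+ 2 * 2 ^ suc r) e≡) (next (2 ^ r) w))
    where
      start : ∀ P w → 2 * suc (2 * w) * P + 0 * (2 * P) ≡ (2 * P) * suc (2 * w)
      start = solve-∀
      next : ∀ P w → 2 * suc (2 * w) * P + 2 * (2 * P) ≡ (2 * P) * suc (2 * suc w)
      next = solve-∀
  ...   | w , inj₁ refl = consecutive-pair r e 1 3 (suc r) w (s≤s z≤n) ≤-refl fits (trans (cong (_+ 1 * 2 ^ suc r) e≡) (start (2 ^ r) w))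
                            (trans (cong (_+ 3 * 2 ^ suc r) e≡) (next (2 ^ r) w))
    where
      start : ∀ P w → 2 * (2 * w) * P + 1 * (2 * P) ≡ (2 * P) * suc (2 * w)
      start = solve-∀
      next : ∀ P w → 2 * (2 * w) * P + 3 * (2 * P) ≡ (2 * P) * suc (2 * suc w)
      next = solve-∀

  sign-within-four : ∀ r e → 2 ^ r ∣ e → e + 3 * 2 ^ suc r ≤ length R → ∀ v →
                     ∃ λ κ → κ ≤ 3 × term R (e + κ * 2 ^ suc r) ≡ v
  sign-within-four r e 2ʳ∣e fits v with opposite-pair r e 2ʳ∣e fits
  ... | κ₁ , κ₂ , κ₁≤3 , κ₂≤3 , opposite with opposite-signs-cover _ _ opposite v
  ...   | inj₁ first≡v  = κ₁ , κ₁≤3 , first≡v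
  ...   | inj₂ second≡v = κ₂ , κ₂≤3 , second≡v

  -- A block of m ≤ 2ʳ entries of R at offset β + n·2ʳ⁺¹ equals the one at offset β + n′·2ʳ⁺¹
  -- as soon as the two agree at the multiples of 2ʳ: elsewhere R is 2ʳ⁺¹-periodic.
  shift-block : ∀ r β m n n′ → β + n * 2 ^ suc r + m ≤ length R → β + n′ * 2 ^ suc r + m ≤ length R →
    (∀ t → t < m → 2 ^ r ∣ suc (β + t) →
       term R (suc (β + t) + n * 2 ^ suc r) ≡ term R (suc (β + t) + n′ * 2 ^ suc r)) →
    ∀ t → t < m → at R (β + n * 2 ^ suc r + t) ≡ at R (β + n′ * 2 ^ suc r + t)
  shift-block r β m n n′ fits fits′ on-multiples t t<m = begin
      at R (β + n * D + t)     ≡⟨ cong (term R) (reorder n) ⟩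
      term R (e + n * D)       ≡⟨ agree (2 ^ r ∣? e) ⟩
      term R (e + n′ * D)      ≡⟨ cong (term R) (reorder n′) ⟨
      at R (β + n′ * D + t)    ∎
    where
      open ≡-Reasoning
      D e : ℕ
      D = 2 ^ suc r
      e = suc (β + t)
      rearrange : ∀ β n D t → suc (β + n * D + t) ≡ suc (β + t) + n * D
      rearrange = solve-∀
      reorder : ∀ n → suc (β + n * D + t) ≡ e + n * D
      reorder n = rearrange β n D t
      inside : ∀ n → β + n * D + m ≤ length R → e + n * D ≤ length R
      inside n fits = subst (_≤ length R) (reorder n)
                        (≤-trans (subst (_≤ β + n * D + m) (+-suc _ t) (+-monoʳ-≤ _ t<m)) fits)
      agree : Dec (2 ^ r ∣ e) → term R (e + n * D) ≡ term R (e + n′ * D)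
      agree (yes 2ʳ∣e) = on-multiples t t<m 2ʳ∣e
      agree (no 2ʳ∤e)  = trans (periodic-off-multiples r e n z<s 2ʳ∤e (inside n fits))
                           (sym (periodic-off-multiples r e n′ z<s 2ʳ∤e (inside n′ fits′)))

-- Relocation of a block, in an alternating R: a block of m ≤ 2ʳ entries at offset x = β + a·2ʳ⁺¹
-- is to be moved into the window of length L ≥ 9·2ʳ - 1 at offset y, where β + c·2ʳ⁺¹ is the first
-- offset ≥ y congruent to x.  The block goes to one of the four offsets β + (c + κ)·2ʳ⁺¹, κ ≤ 3:
-- it contains at most one multiple of 2ʳ, and one of the four choices gives that term its sign.
module Relocation {R : List Sign} (alt : Alternating R) (r x y m L : ℕ) (m≤2ʳ : m ≤ 2 ^ r)
                  (x-fits : x + m ≤ length R) (y-fits : y + L ≤ length R) (L-long : 9 * 2 ^ r ≤ suc L)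
                  (β a c : ℕ) (x≡ : x ≡ β + a * 2 ^ suc r)
                  (y≤ : y ≤ β + c * 2 ^ suc r) (<y+D : β + c * 2 ^ suc r < y + 2 ^ suc r) where
  open AlternatingProperties {R} alt

  D : ℕ
  D = 2 ^ suc r

  window-fit : ∀ κ → κ ≤ 3 → β + (c + κ) * D + m ≤ y + L
  window-fit κ κ≤3 = ≤-pred (begin
      suc (β + (c + κ) * D + m)          ≡⟨ regroup β c κ D m ⟩
      suc (β + c * D) + (κ * D + m)      ≤⟨ +-mono-≤ <y+D (+-mono-≤ (*-monoˡ-≤ D κ≤3) m≤2ʳ) ⟩
      (y + D) + (3 * D + 2 ^ r)          ≡⟨ nine y (2 ^ r) ⟩
      y + 9 * 2 ^ r                      ≤⟨ +-monoʳ-≤ y L-long ⟩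
      y + suc L                          ≡⟨ +-suc y L ⟩
      suc (y + L)                        ∎)
    where
      open ≤-Reasoning
      regroup : ∀ β c κ D m → suc (β + (c + κ) * D + m) ≡ suc (β + c * D) + (κ * D + m)
      regroup = solve-∀
      nine : ∀ y P → (y + 2 * P) + (3 * (2 * P) + P) ≡ y + 9 * P
      nine = solve-∀

  move-to : ∀ κ → κ ≤ 3 →
    (∀ t → t < m → 2 ^ r ∣ suc (β + t) → term R (suc (β + t) + (c + κ) * D) ≡ term R (suc (β + t) + a * D)) →
    ∃ λ x′ → y ≤ x′ × x′ + m ≤ y + L × (∀ t → t < m → at R (x′ + t) ≡ at R (x + t))
  move-to κ κ≤3 on-multiples =
    β + (c + κ) * D ,
    ≤-trans y≤ (+-monoʳ-≤ β (*-monoˡ-≤ D (m≤m+n c κ))) ,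
    window-fit κ κ≤3 ,
    λ t t<m → trans (shift-block r β m (c + κ) a (≤-trans (window-fit κ κ≤3) y-fits)
                       (subst (λ z → z + m ≤ length R) x≡ x-fits) on-multiples t t<m)
                    (cong (λ z → at R (z + t)) (sym x≡))

  -- a multiple of 2ʳ at position t₀ of the block: choose κ giving it the sign it has at offset x
  move-multiple : ∀ t₀ → t₀ < m → 2 ^ r ∣ suc (β + t₀) →
    ∃ λ x′ → y ≤ x′ × x′ + m ≤ y + L × (∀ t → t < m → at R (x′ + t) ≡ at R (x + t))
  move-multiple t₀ t₀<m 2ʳ∣ = move-chosen (sign-within-four r (e + c * D) 2ʳ∣e+cD four-fit (term R (e + a * D)))
    where
      e : ℕ
      e = suc (β + t₀)
      2ʳ∣e+cD : 2 ^ r ∣ e + c * D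
      2ʳ∣e+cD = ∣m∣n⇒∣m+n 2ʳ∣ (∣n⇒∣m*n c (n∣m*n 2))
      regroup-four : ∀ β t c D → suc (β + t) + c * D + 3 * D ≡ β + (c + 3) * D + suc t
      regroup-four = solve-∀
      four-fit : e + c * D + 3 * D ≤ length R
      four-fit = subst (_≤ length R) (sym (regroup-four β t₀ c D))
                   (≤-trans (+-monoʳ-≤ (β + (c + 3) * D) t₀<m) (≤-trans (window-fit 3 ≤-refl) y-fits))
      regroup-κ : ∀ e c κ D → e + (c + κ) * D ≡ e + c * D + κ * D
      regroup-κ = solve-∀
      move-chosen : (∃ λ κ → κ ≤ 3 × term R (e + c * D + κ * D) ≡ term R (e + a * D)) →
        ∃ λ x′ → y ≤ x′ × x′ + m ≤ y + L × (∀ t → t < m → at R (x′ + t) ≡ at R (x + t))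
      move-chosen (κ , κ≤3 , chosen) = move-to κ κ≤3 on-multiples
        where
          on-multiples : ∀ t → t < m → 2 ^ r ∣ suc (β + t) →
                         term R (suc (β + t) + (c + κ) * D) ≡ term R (suc (β + t) + a * D)
          on-multiples t t<m 2ʳ∣′ with multiple-in-block-unique (suc β) t t₀ (≤-trans t<m m≤2ʳ) (≤-trans t₀<m m≤2ʳ) 2ʳ∣′ 2ʳ∣
          ... | refl = trans (cong (term R) (regroup-κ e c κ D)) chosen

  relocate-block : ∃ λ x′ → y ≤ x′ × x′ + m ≤ y + L × (∀ t → t < m → at R (x′ + t) ≡ at R (x + t))
  relocate-block with any? (λ (i : Fin m) → 2 ^ r ∣? suc (β + toℕ i))
  ... | yes (i , 2ʳ∣) = move-multiple (toℕ i) (toℕ<n i) 2ʳ∣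
  ... | no no-multiple = move-to 0 z≤n λ t t<m 2ʳ∣ →
          contradiction (fromℕ< t<m , subst (λ s → 2 ^ r ∣ suc (β + s)) (sym (toℕ-fromℕ< t<m)) 2ʳ∣) no-multiple

relocate : ∀ {R} → Alternating R → ∀ r x y m L → m ≤ 2 ^ r → x + m ≤ length R → y + L ≤ length R →
  9 * 2 ^ r ≤ suc L → ∃ λ x′ → y ≤ x′ × x′ + m ≤ y + L × (∀ t → t < m → at R (x′ + t) ≡ at R (x + t))
relocate {R} alt r x y m L m≤2ʳ x-fits y-fits L-long with divide x (2 ^ suc r) {{m^n≢0 2 (suc r)}}
... | β , a , β<D , x≡ with residue-in-window y β (2 ^ suc r) (m^n>0 2 (suc r)) β<D
...   | c , y≤ , <y+D = Relocation.relocate-block {R} alt r x y m L m≤2ʳ x-fits y-fits L-long β a c x≡ y≤ <y+D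

alternating-occurs-in-window : ∀ {R} → Alternating R → ∀ r X Y x y → Occurs X R x → Occurs Y R y →
                               length X ≤ 2 ^ r → 9 * 2 ^ r ≤ suc (length Y) → ∃ (Occurs X Y)
alternating-occurs-in-window {R} alt r X Y x y (x-fits , x-agrees) (y-fits , y-agrees) |X|≤ |Y|≥
  with relocate {R} alt r x y (length X) (length Y) |X|≤ x-fits y-fits |Y|≥
... | x′ , y≤x′ , x′-fits , x′-agrees with m≤n⇒∃[o]m+o≡n y≤x′
...   | δ , refl = δ , δ-fits , δ-agrees
  where
    δ-fits : δ + length X ≤ length Y
    δ-fits = +-cancelˡ-≤ y _ _ (subst (_≤ y + length Y) (+-assoc y δ (length X)) x′-fits)
    δ-agrees : ∀ t → t < length X → at X t ≡ at Y (δ + t)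
    δ-agrees t t< = begin
        at X t              ≡⟨ x-agrees t t< ⟩
        at R (x + t)        ≡⟨ x′-agrees t t< ⟨
        at R (y + δ + t)    ≡⟨ cong (at R) (+-assoc y δ t) ⟩
        at R (y + (δ + t))  ≡⟨ y-agrees (δ + t) (<-≤-trans (+-monoʳ-< δ t<) δ-fits) ⟨
        at Y (δ + t)        ∎
      where open ≡-Reasoning

folding-subword-in-window : ∀ {n F} → FoldingSeq n F → ∀ r T W → SubwordL T F → SubwordL W F →
                            length T ≤ 2 ^ r → 9 * 2 ^ r ≤ suc (length W) → SubwordL T W
folding-subword-in-window {F = F} folding r T W T⊑F W⊑F |T|≤ |W|≥
  with subword⇒occurs (reverse T) (reverse F) (subword-reverse T⊑F)
     | subword⇒occurs (reverse W) (reverse F) (subword-reverse W⊑F)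
... | x , T-occurs | y , W-occurs
  with alternating-occurs-in-window {reverse F} (proj₂ (folding-alternating folding)) r (reverse T) (reverse W) x y
         T-occurs W-occurs (subst (_≤ 2 ^ r) (sym (length-reverse T)) |T|≤)
         (subst (λ l → 9 * 2 ^ r ≤ suc l) (sym (length-reverse W)) |W|≥)
... | δ , occurs = subst₂ SubwordL (reverse-involutive T) (reverse-involutive W)
                     (subword-reverse (occurs⇒subword (reverse T) (reverse W) δ occurs))

window-subwordZ : ∀ a h n → SubwordZ (window a h n) a
window-subwordZ a h n = h , window-lookup h n
  where
    window-lookup : ∀ h n i → lookup (window a h n) i ≡ a (h Z.+ Z.+ suc (toℕ i))
    window-lookup h (suc n) zero    = refl
    window-lookup h (suc n) (suc i) =
      trans (window-lookup (h Z.+ Z.+ 1) n i) (cong a (ZP.+-assoc h (Z.+ 1) (Z.+ suc (toℕ i))))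

subwordZ-window : ∀ a T h → (∀ i → lookup T i ≡ a (h Z.+ Z.+ suc (toℕ i))) → T ≡ window a h (length T)
subwordZ-window a []      h at-h = refl
subwordZ-window a (x ∷ T) h at-h = cong₂ _∷_ (at-h zero) (subwordZ-window a T (h Z.+ Z.+ 1) at-next)
  where
    at-next : ∀ i → lookup T i ≡ a ((h Z.+ Z.+ 1) Z.+ Z.+ suc (toℕ i))
    at-next i = trans (at-h (suc i)) (cong a (sym (ZP.+-assoc h (Z.+ 1) (Z.+ suc (toℕ i)))))

length-window : ∀ a h n → length (window a h n) ≡ n
length-window a h zero    = refl
length-window a h (suc n) = cong suc (length-window a (h Z.+ Z.+ 1) n)

window-++ : ∀ a h p q → window a h (p + q) ≡ window a h p ++ window a (h Z.+ Z.+ p) q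
window-++ a h zero    q = cong (λ g → window a g q) (sym (ZP.+-identityʳ h))
window-++ a h (suc p) q = cong (a (h Z.+ Z.+ 1) ∷_)
  (trans (window-++ a (h Z.+ Z.+ 1) p q)
         (cong (λ g → window a (h Z.+ Z.+ 1) p ++ window a g q) (ZP.+-assoc h (Z.+ 1) (Z.+ p))))

window-in-window : ∀ a h d n k → SubwordL (window a (h Z.+ Z.+ d) n) (window a h (d + n + k))
window-in-window a h d n k = window a h d , window a ((h Z.+ Z.+ d) Z.+ Z.+ n) k ,
  trans (cong (window a h) (+-assoc d n k))
        (trans (window-++ a h d (n + k)) (cong (window a h d ++_) (window-++ a (h Z.+ Z.+ d) n k)))

above : ∀ {u v} → u Z.≤ v → v ≡ u Z.+ Z.+ Z.∣ v Z.- u ∣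
above {u} {v} u≤v = sym (trans (cong (λ k → u Z.+ k) (ZP.0≤i⇒+∣i∣≡i (ZP.i≤j⇒0≤j-i u≤v))) (cancel u v))
  where
    cancel : ∀ u v → u Z.+ (v Z.- u) ≡ v
    cancel = Z-solve-∀

common-base : ∀ u v → ∃₂ λ base d₁ → ∃ λ d₂ → u ≡ base Z.+ Z.+ d₁ × v ≡ base Z.+ Z.+ d₂
common-base u v with ZP.≤-total u v
... | inj₁ u≤v = u , 0 , Z.∣ v Z.- u ∣ , sym (ZP.+-identityʳ u) , above u≤v
... | inj₂ v≤u = v , Z.∣ u Z.- v ∣ , 0 , above v≤u , sym (ZP.+-identityʳ v)

common-window : ∀ a h₀ n₀ h n → ∃₂ λ b N →
                SubwordL (window a h₀ n₀) (window a b N) × SubwordL (window a h n) (window a b N)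
common-window a h₀ n₀ h n with common-base h₀ h
... | b , d₁ , d₂ , refl , refl =
  b , d₁ + n₀ + (d₂ + n) , window-in-window a b d₁ n₀ (d₂ + n) ,
  subst (λ N → SubwordL (window a (b Z.+ Z.+ d₂) n) (window a b N)) (+-comm (d₂ + n) (d₁ + n₀))
        (window-in-window a b d₂ n (d₁ + n₀))

window-length-suffices : ∀ r → 9 * 2 ^ r ≤ suc (10 * 2 ^ r ∸ 2)
window-length-suffices r with 2 ^ r | m^n>0 2 r
... | suc P | _ = begin
    9 * suc P                  ≡⟨ nine P ⟩
    9 + 9 * P                  ≤⟨ +-monoʳ-≤ 9 (*-monoˡ-≤ P (n≤1+n 9)) ⟩
    9 + 10 * P                 ≡⟨ cong suc (m+n∸m≡n 2 (8 + 10 * P)) ⟨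
    suc (2 + (8 + 10 * P) ∸ 2) ≡⟨ cong (λ k → suc (k ∸ 2)) (ten P) ⟨
    suc (10 * suc P ∸ 2)       ∎
  where
    open ≤-Reasoning
    nine : ∀ P → 9 * suc P ≡ 9 + 9 * P
    nine = solve-∀
    ten : ∀ P → 10 * suc P ≡ 2 + (8 + 10 * P)
    ten = solve-∀

theorem1p10 : (a : BiSeq) → CompleteFolding a →
    (T : List Sign) → SubwordZ T a →
    (r : ℕ) → length T ≤ 2 ^ r →
    (h : ℤ) → SubwordL T (window a h (10 * 2 ^ r ∸ 2))
theorem1p10 a complete T (h₀ , T-at-h₀) r |T|≤2ʳ h
  with common-window a h₀ (length T) h (10 * 2 ^ r ∸ 2)
... | b , N , T⊑U , W⊑U with complete (window a b N) (window-subwordZ a b N)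
...   | n , F , folding , U⊑F =
  folding-subword-in-window folding r T W (subword-trans T⊑U′ U⊑F) (subword-trans W⊑U U⊑F) |T|≤2ʳ W-long
  where
    W : List Sign
    W = window a h (10 * 2 ^ r ∸ 2)
    T⊑U′ : SubwordL T (window a b N)
    T⊑U′ = subst (λ X → SubwordL X (window a b N)) (sym (subwordZ-window a T h₀ T-at-h₀)) T⊑U
    W-long : 9 * 2 ^ r ≤ suc (length W)
    W-long = subst (λ l → 9 * 2 ^ r ≤ suc l) (sym (length-window a h (10 * 2 ^ r ∸ 2))) (window-length-suffices r)
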